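{- Let $\mathcal{L}_1\subseteq\mathcal{L}_2$ be propositional languages, $\mathcal{L}_2$ extending $\mathcal{L}_1$ by some set of connectives. Let $\mathbf{G}_1$ be a coherent canonical system in $\mathcal{L}_1$, and let $\mathbf{G}_2$ be a coherent canonical system in $\mathcal{L}_2$ obtained from $\mathbf{G}_1$ by adding canonical rules for connectives in $\mathcal{L}_2\setminus\mathcal{L}_1$. Then $\mathbf{G}_2$ is a conservative extension of $\mathbf{G}_1$: for every set $\mathcal S$ of sequents and sequent $s$, all in $\mathcal{L}_1$, $\mathcal{S}\vdash^{seq}_{\mathbf{G}_1}s$ iff $\mathcal{S}\vdash^{seq}_{\mathbf{G}_2}s$.
   Context: For a propositional language $\mathcal{L}$ with atoms $p_1,p_2,\ldots$ and formulas $\mathcal{F}$: a sequent is $\Gamma\Rightarrow E$ with $\Gamma$ a finite set of formulas and $E$ a set of formulas with at most one element. A clause is a sequent of atoms. An $\mathcal{L}$-substitution is a map $\sigma:\mathcal{F}\to\mathcal{F}$ commuting with all connectives, extended pointwise to sets. A canonical right-introduction rule for an $n$-ary connective $\diamond$ is $\{\Pi_i\Rightarrow E_i\}_{1\le i\le m}/\ \Rightarrow\diamond(p_1,\dots,p_n)$ with $m\ge0$ and $\Pi_i\cup E_i\subseteq\{p_1,\dots,p_n\}$; an application infers $\Gamma\Rightarrow\sigma(\diamond(p_1,\dots,p_n))$ from $\Gamma,\sigma(\Pi_i)\Rightarrow\sigma(E_i)$ ($1\le i\le m$), for any finite $\Gamma$ and $\mathcal L$-substitution $\sigma$. A canonical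 left-introduction rule is $\langle\{\Pi_i\Rightarrow E_i\}_{1\le i\le m},\{\Sigma_j\Rightarrow\}_{1\le j\le k}\rangle/\ \diamond(p_1,\dots,p_n)\Rightarrow$ with all atoms among $p_1,\dots,p_n$; an application infers $\Gamma,\sigma(\diamond(p_1,\dots,p_n))\Rightarrow E$ from $\Gamma,\sigma(\Pi_i)\Rightarrow\sigma(E_i)$ and $\Gamma,\sigma(\Sigma_j)\Rightarrow E$, for any sequent $\Gamma\Rightarrow E$ and $\sigma$. A canonical system in $\mathcal L$ has axioms $\varphi\Rightarrow\varphi$ ($\varphi$ in $\mathcal L$), weakening (from $\Gamma\Rightarrow E$ infer $\Gamma,\Delta\Rightarrow E$; from $\Gamma\Rightarrow$ infer $\Gamma\Rightarrow\psi$), cut (from $\Gamma\Rightarrow\varphi$ and $\Delta,\varphi\Rightarrow E$ infer $\Gamma,\Delta\Rightarrow E$), and a set of canonical right- and left-introduction rules for connectives of $\mathcal L$, all sequents being in $\mathcal L$. $\mathcal{S}\vdash^{seq}_{\mathbf G}s$ means $s$ is derivable in $\mathbf G$ from the sequents of $\mathcal S$ as extra axioms. A classical assignment $u$ satisfies a clause $\Pi\Rightarrow E$ iff $u(p)=f$ for some $p\in\Pi$ or $E=\{q\}$ with $u(q)=t$; $\mathbf G$ is coherent iff for every connective $\diamond$, whenever $\mathbf G$ contains a left rule $\langle S_1,S_2\rangle/\diamond(p_1,\dots,p_n)\Rightarrow$ and a right rule $S_3/\Rightarrow\diamond(p_1,\dots,p_n)$, no assignment satisfies all clauses of $S_1\cup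 S_2\cup S_3$. -}

module Defs where

open import Data.Nat using (ℕ)
open import Data.Fin using (Fin; toℕ)
open import Data.Bool using (Bool; true; false)
open import Data.Maybe using (Maybe; just; nothing)
open import Data.List using (List; []; _∷_; _++_; map)
open import Data.List.Relation.Unary.All using (All)
open import Data.List.Relation.Unary.Any using (Any)
open import Data.List.Membership.Propositional using (_∈_)
open import Data.Vec using (Vec; tabulate)
import Data.Vec as Vec
import Data.Vec.Relation.Unary.All as VAll
open import Data.Product using (_×_; _,_; ∃; proj₁; proj₂)
open import Data.Sum using (_⊎_)
open import Relation.Binary.PropositionalEquality using (_≡_)
open import Relation.Nullary using (¬_)

record Signature : Set₁ where
  field
    Con   : Set
    arity : Con → ℕ

module _ (Sg : Signature) where
  open Signature Sg

  data Formula : Set where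
    atom : ℕ → Formula
    app  : (c : Con) → Vec Formula (arity c) → Formula

  Language : Set₁
  Language = Con → Set

  data InL (L : Language) : Formula → Set where
    atomL : ∀ p → InL L (atom p)
    appL  : ∀ {c args} → L c → VAll.All (InL L) args → InL L (app c args)

  -- Sequents Γ ⇒ E: Γ finite (list, read as a set), E of size ≤ 1.
  record Sequent : Set where
    constructor _⇒_
    field
      ante : List Formula
      succ : Maybe Formula
  open Sequent public

  SeqIn : Language → Sequent → Set
  SeqIn L (Γ ⇒ E) = All (InL L) Γ × (∀ {φ} → E ≡ just φ → InL L φ)

  Subst : Set
  Subst = ℕ → Formula

  mutual
    sub : Subst → Formula → Formula
    sub σ (atom p)     = σ p
    sub σ (app c args) = app c (subs σ args)

    subs : ∀ {n} → Subst → Vec Formula n → Vec Formula n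
    subs σ Vec.[]       = Vec.[]
    subs σ (φ Vec.∷ φs) = sub σ φ Vec.∷ subs σ φs

  IsLSubst : Language → Subst → Set
  IsLSubst L σ = ∀ p → InL L (σ p)

  -- Clauses over the atoms p₀ … p_{n-1} (atom i ↦ p_{toℕ i}).
  record Clause (n : ℕ) : Set where
    constructor _⇒c_
    field
      prem  : List (Fin n)
      concl : Maybe (Fin n)
  open Clause public

  RightRule : ℕ → Set
  RightRule n = List (Clause n)

  -- ⟨ {Πᵢ ⇒ Eᵢ} , {Σⱼ ⇒} ⟩
  LeftRule : ℕ → Set
  LeftRule n = List (Clause n) × List (List (Fin n))

  pat : (c : Con) → Formula
  pat c = app c (tabulate (λ i → atom (toℕ i)))

  instΠ : ∀ {n} → Subst → List (Fin n) → List Formula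
  instΠ σ Π = map (λ i → sub σ (atom (toℕ i))) Π

  instE : ∀ {n} → Subst → Maybe (Fin n) → Maybe Formula
  instE σ nothing  = nothing
  instE σ (just i) = just (sub σ (atom (toℕ i)))

  record System : Set₁ where
    field
      Right : (c : Con) → RightRule (arity c) → Set
      Left  : (c : Con) → LeftRule (arity c) → Set
  open System public

  RulesIn : Language → System → Set
  RulesIn L G = (∀ c r → Right G c r → L c) × (∀ c r → Left G c r → L c)

  -- Weakening is stated for sets:
  -- from Γ ⇒ E infer Γ' ⇒ E whenever Γ ⊆ Γ' (i.e. Γ' = Γ ∪ Δ).
  data Der (L : Language) (G : System) (S : Sequent → Set) : Sequent → Set where
    hyp   : ∀ {s} → S s → SeqIn L s → Der L G S s
    ax    : ∀ {φ} → InL L φ → Der L G S ((φ ∷ []) ⇒ just φ)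
    weak  : ∀ {Γ Γ' E} → (∀ {φ} → φ ∈ Γ → φ ∈ Γ') → Der L G S (Γ ⇒ E) →
            SeqIn L (Γ' ⇒ E) → Der L G S (Γ' ⇒ E)
    weakR : ∀ {Γ ψ} → Der L G S (Γ ⇒ nothing) → SeqIn L (Γ ⇒ just ψ) →
            Der L G S (Γ ⇒ just ψ)
    cut   : ∀ {Γ Δ φ E} → Der L G S (Γ ⇒ just φ) → Der L G S ((φ ∷ Δ) ⇒ E) →
            SeqIn L ((Γ ++ Δ) ⇒ E) → Der L G S ((Γ ++ Δ) ⇒ E)
    rightI : ∀ {Γ} c (r : RightRule (arity c)) (σ : Subst) → Right G c r → IsLSubst L σ →
            All (λ cl → Der L G S ((Γ ++ instΠ σ (prem cl)) ⇒ instE σ (concl cl))) r →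
            SeqIn L (Γ ⇒ just (sub σ (pat c))) →
            Der L G S (Γ ⇒ just (sub σ (pat c)))
    leftI : ∀ {Γ E} c (r : LeftRule (arity c)) (σ : Subst) → Left G c r → IsLSubst L σ →
            All (λ cl → Der L G S ((Γ ++ instΠ σ (prem cl)) ⇒ instE σ (concl cl))) (proj₁ r) →
            All (λ Σj → Der L G S ((Γ ++ instΠ σ Σj) ⇒ E)) (proj₂ r) →
            SeqIn L ((sub σ (pat c) ∷ Γ) ⇒ E) →
            Der L G S ((sub σ (pat c) ∷ Γ) ⇒ E)

  Assignment : Set
  Assignment = ℕ → Bool

  Sat : ∀ {n} → Assignment → Clause n → Set
  Sat u (Π ⇒c E) = Any (λ p → u (toℕ p) ≡ false) Π ⊎ (∃ λ q → E ≡ just q × u (toℕ q) ≡ true)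

  clauses : ∀ {n} → LeftRule n → RightRule n → List (Clause n)
  clauses l r = proj₁ l ++ map (λ Σj → Σj ⇒c nothing) (proj₂ l) ++ r

  Coherent : System → Set
  Coherent G = ∀ c (l : LeftRule (arity c)) (r : RightRule (arity c)) →
               Left G c l → Right G c r → (u : Assignment) → ¬ All (Sat u) (clauses l r)

  AddsRulesOutside : Language → System → System → Set
  AddsRulesOutside L₁ G₁ G₂ =
    (∀ c r → Right G₁ c r → Right G₂ c r) ×
    (∀ c r → Left G₁ c r → Left G₂ c r) ×
    (∀ c r → Right G₂ c r → Right G₁ c r ⊎ ¬ L₁ c) ×
    (∀ c r → Left G₂ c r → Left G₁ c r ⊎ ¬ L₁ c)

-- Derivability only grows with the language and the rule set, so
-- the content is that G₂ proves no new L₁-sequents.  This is a semantic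
-- cut-elimination argument by orthogonality.  The counters of a formula φ are
-- the L₁-sequents Δ ⇒ E such that φ, Δ ⇒ E is derivable in G₁, or such that φ
-- is c(ψ⃗) and the premises of some left rule of G₂ for c hold semantically of
-- Δ, E and ψ⃗.  A context X forces φ if X, Δ ⇒ E is G₁-derivable for every
-- counter Δ ⇒ E of φ, and a sequent is valid if every context forcing its
-- antecedent forces (or, for an empty succedent, derives) its succedent.
-- Every rule of G₂ preserves validity.  The one non-trivial case is a right
-- rule for c whose conclusion meets a counter coming from a left rule for c:
-- by coherence the premises of the two rules form an unsatisfiable set of Horn
-- clauses, so forward chaining through them derives the goal.  Finally every
-- L₁-formula forces itself (a left rule of G₂ for an L₁-connective is a rule
-- of G₁), so valid L₁-sequents are G₁-derivable.

module Submission where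

open import Defs
open import Data.Nat using (ℕ; _∸_; _<_; _<?_)
open import Data.Nat.Induction using (<-wellFounded)
open import Data.Nat.Properties using (∸-monoʳ-<)
open import Data.Fin using (Fin; zero; suc; toℕ; fromℕ<)
open import Data.Fin.Properties using (toℕ<n; fromℕ<-toℕ)
open import Data.Fin.Subset using (Subset; _⊂_; _∪_; ⁅_⁆; ∣_∣)
  renaming (_∈_ to _∈ₛ_; _∉_ to _∉ₛ_; ⊥ to ∅)
open import Data.Fin.Subset.Properties
  using (∉⊥; x∈⁅x⁆; x∈⁅y⁆⇒x≡y; p⊆p∪q; x∈p∪q⁺; x∈p∪q⁻; ∣p∣≤n; p⊂q⇒∣p∣<∣q∣)
open import Data.Bool using (true; false)
open import Data.Bool.Properties using (¬-not) renaming (_≟_ to _≟ᵇ_)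
open import Data.Maybe using (Maybe; just; nothing)
open import Data.List using (List; []; _∷_; _++_)
open import Data.List.Properties using (map-cong; ++-identityʳ)
open import Data.List.Relation.Unary.All as All using (All; []; _∷_; all?)
import Data.List.Relation.Unary.All.Properties as AllP
open import Data.List.Relation.Unary.All.Properties using (¬All⇒Any¬; ¬Any⇒All¬)
open import Data.List.Relation.Unary.Any using (any?)
open import Data.List.Membership.Propositional using (_∈_)
open import Data.List.Membership.Propositional.Properties using (∈-++⁻; ∈-++⁺ʳ; ∈-map⁺)
open import Data.List.Relation.Binary.Subset.Propositional using (_⊆_)
open import Data.List.Relation.Binary.Subset.Propositional.Properties
  using (⊆-refl; ⊆-trans; ⊆-reflexive-↭; ++⁺ˡ; xs⊆xs++ys; xs⊆ys++xs; xs⊆x∷xs; ∈-∷⁺ʳ)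
open import Data.List.Relation.Binary.Permutation.Propositional using (↭-sym)
open import Data.List.Relation.Binary.Permutation.Propositional.Properties using (shift)
open import Data.Vec as Vec using (Vec; []; _∷_; lookup; tabulate)
open import Data.Vec.Properties
  using ([]=⇒lookup; lookup⇒[]=; lookup-map; lookup∘tabulate; tabulate∘lookup; tabulate-cong)
import Data.Vec.Relation.Unary.All as VAll
open VAll using ([]; _∷_)
import Data.Vec.Relation.Unary.All.Properties as VAllP
open import Data.Product using (_×_; _,_; ∃; proj₁; proj₂)
open import Data.Sum using (_⊎_; inj₁; inj₂; [_,_]′)
open import Function using (_∘_; id)
open import Induction.WellFounded using (WellFounded; Acc; acc; module Subrelation)
open import Relation.Binary.Construct.On as On using ()
open import Relation.Binary.PropositionalEquality
open import Relation.Nullary using (¬_; Dec; yes; no; contradiction)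
open import Relation.Nullary.Decidable using (_⊎-dec_)

-- Forward chaining in unsatisfiable Horn clause sets

Conclusion : ∀ {n} → (Fin n → Set) → Set → Maybe (Fin n) → Set
Conclusion P G nothing  = G
Conclusion P G (just q) = P q

module _ {Sg : Signature} {n : ℕ} where

  Closed : (Fin n → Set) → Set → Clause Sg n → Set
  Closed P G (Π ⇒c E) = All P Π → Conclusion P G E

  assignment : Subset n → Assignment Sg
  assignment p k with k <? n
  ... | yes k<n = lookup p (fromℕ< k<n)
  ... | no  _   = false

  assignment-toℕ : ∀ p (i : Fin n) → assignment p (toℕ i) ≡ lookup p i
  assignment-toℕ p i with toℕ i <? n
  ... | yes i<n = cong (lookup p) (fromℕ<-toℕ i i<n)
  ... | no  i≮n = contradiction (toℕ<n i) i≮n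

  ∈⇒assigned : ∀ {p} {i : Fin n} → i ∈ₛ p → assignment p (toℕ i) ≡ true
  ∈⇒assigned {p} {i} i∈p = trans (assignment-toℕ p i) ([]=⇒lookup i∈p)

  assigned⇒∈ : ∀ {p} {i : Fin n} → assignment p (toℕ i) ≡ true → i ∈ₛ p
  assigned⇒∈ {p} {i} eq = lookup⇒[]= i p (trans (sym (assignment-toℕ p i)) eq)

  sat? : ∀ u (cl : Clause Sg n) → Dec (Sat Sg u cl)
  sat? u (Π ⇒c E) = any? (λ i → u (toℕ i) ≟ᵇ false) Π ⊎-dec conclusion? E
    where
    conclusion? : ∀ E → Dec (∃ λ q → E ≡ just q × u (toℕ q) ≡ true)
    conclusion? nothing  = no λ ()
    conclusion? (just q) with u (toℕ q) ≟ᵇ true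
    ... | yes uq = yes (q , refl , uq)
    ... | no ¬uq = no λ { (_ , refl , uq) → ¬uq uq }

  falsified⇒premises∈ : ∀ {p Π E} → ¬ Sat Sg (assignment p) (Π ⇒c E) → All (_∈ₛ p) Π
  falsified⇒premises∈ {p} {Π} ¬sat =
    All.map (λ ¬false → assigned⇒∈ (¬-not ¬false))
            (¬Any⇒All¬ {P = λ i → assignment p (toℕ i) ≡ false} Π (¬sat ∘ inj₁))

  falsified⇒conclusion∉ : ∀ {p Π q} → ¬ Sat Sg (assignment p) (Π ⇒c just q) → q ∉ₛ p
  falsified⇒conclusion∉ ¬sat q∈p = ¬sat (inj₂ (_ , refl , ∈⇒assigned q∈p))

  _⊃_ : Subset n → Subset n → Set
  p ⊃ q = q ⊂ p

  ⊃-wellFounded : WellFounded _⊃_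
  ⊃-wellFounded =
    Subrelation.wellFounded ⊃⇒∁-card< (On.wellFounded (λ p → n ∸ ∣ p ∣) <-wellFounded)
    where
    ⊃⇒∁-card< : ∀ {p q} → p ⊃ q → n ∸ ∣ p ∣ < n ∸ ∣ q ∣
    ⊃⇒∁-card< {p} q⊂p = ∸-monoʳ-< (p⊂q⇒∣p∣<∣q∣ q⊂p) (∣p∣≤n p)

  ∉⇒⊂∪⁅⁆ : ∀ {p} {q : Fin n} → q ∉ₛ p → p ⊂ p ∪ ⁅ q ⁆
  ∉⇒⊂∪⁅⁆ {q = q} q∉p = p⊆p∪q _ , q , x∈p∪q⁺ (inj₂ (x∈⁅x⁆ q)) , q∉p

  -- Grow the set p of atoms known to satisfy P: a clause falsified by p either
  -- fires the goal or adds a new atom, and unsatisfiability means there always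
  -- is such a clause.
  unsat-closed⇒goal : ∀ {P G} (K : List (Clause Sg n)) → (∀ u → ¬ All (Sat Sg u) K) →
                      All (Closed P G) K → G
  unsat-closed⇒goal {P} {G} K unsat closed =
    chain ∅ (⊃-wellFounded ∅) (λ i∈∅ → contradiction i∈∅ ∉⊥)
    where
    chain : ∀ p → Acc _⊃_ p → (∀ {i} → i ∈ₛ p → P i) → G
    chain p (acc more) p⊆P with all? (sat? (assignment p)) K
    ... | yes sat = contradiction sat (unsat (assignment p))
    ... | no ¬sat = fire (All.lookupAny closed (¬All⇒Any¬ (sat? (assignment p)) K ¬sat))
      where
      fire : ∀ {cl} → Closed P G cl × ¬ Sat Sg (assignment p) cl → G
      fire {Π ⇒c nothing} (close , ¬sat-cl) = close (All.map p⊆P (falsified⇒premises∈ ¬sat-cl))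
      fire {Π ⇒c just q}  (close , ¬sat-cl) =
        chain (p ∪ ⁅ q ⁆) (more (∉⇒⊂∪⁅⁆ (falsified⇒conclusion∉ ¬sat-cl))) p∪q⊆P
        where
        p∪q⊆P : ∀ {i} → i ∈ₛ p ∪ ⁅ q ⁆ → P i
        p∪q⊆P i∈ with x∈p∪q⁻ p ⁅ q ⁆ i∈
        ... | inj₁ i∈p = p⊆P i∈p
        ... | inj₂ i∈q = subst P (sym (x∈⁅y⁆⇒x≡y q i∈q))
                               (close (All.map p⊆P (falsified⇒premises∈ ¬sat-cl)))

module _ {Sg : Signature} where
  open Signature Sg

  private
    F : Set
    F = Formula Sg

    atoms : ∀ n → Vec F n
    atoms n = tabulate (atom ∘ toℕ)

  instArgs : Subst Sg → (n : ℕ) → Vec F n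
  instArgs σ n = subs Sg σ (atoms n)

  subs-map : ∀ σ {n} (v : Vec F n) → subs Sg σ v ≡ Vec.map (sub Sg σ) v
  subs-map σ []      = refl
  subs-map σ (φ ∷ v) = cong (sub Sg σ φ ∷_) (subs-map σ v)

  lookup-instArgs : ∀ σ {n} (i : Fin n) → lookup (instArgs σ n) i ≡ σ (toℕ i)
  lookup-instArgs σ {n} i = begin
    lookup (subs Sg σ (atoms n)) i          ≡⟨ cong (λ v → lookup v i) (subs-map σ (atoms n)) ⟩
    lookup (Vec.map (sub Sg σ) (atoms n)) i ≡⟨ lookup-map i (sub Sg σ) (atoms n) ⟩
    sub Sg σ (lookup (atoms n) i)           ≡⟨ cong (sub Sg σ) (lookup∘tabulate (atom ∘ toℕ) i) ⟩
    σ (toℕ i)                               ∎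
    where open ≡-Reasoning

  vecSubst : ∀ {n} → Vec F n → Subst Sg
  vecSubst {n} v k with k <? n
  ... | yes k<n = lookup v (fromℕ< k<n)
  ... | no  _   = atom k

  vecSubst-toℕ : ∀ {n} (v : Vec F n) (i : Fin n) → vecSubst v (toℕ i) ≡ lookup v i
  vecSubst-toℕ {n} v i with toℕ i <? n
  ... | yes i<n = cong (lookup v) (fromℕ<-toℕ i i<n)
  ... | no  i≮n = contradiction (toℕ<n i) i≮n

  vecSubst-InL : ∀ {L n} {v : Vec F n} → VAll.All (InL Sg L) v → IsLSubst Sg L (vecSubst v)
  vecSubst-InL {n = n} v∈L k with k <? n
  ... | yes k<n = VAllP.lookup⁺ v∈L (fromℕ< k<n)
  ... | no  _   = atomL k

  instArgs-vecSubst : ∀ {n} (v : Vec F n) → instArgs (vecSubst v) n ≡ v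
  instArgs-vecSubst {n} v = begin
    instArgs (vecSubst v) n                   ≡⟨ tabulate∘lookup _ ⟨
    tabulate (lookup (instArgs (vecSubst v) n)) ≡⟨ tabulate-cong lookup-agrees ⟩
    tabulate (lookup v)                       ≡⟨ tabulate∘lookup v ⟩
    v                                         ∎
    where
    open ≡-Reasoning
    lookup-agrees : ∀ i → lookup (instArgs (vecSubst v) n) i ≡ lookup v i
    lookup-agrees i = trans (lookup-instArgs (vecSubst v) i) (vecSubst-toℕ v i)

  sub-pat-vecSubst : ∀ c (v : Vec F (arity c)) → sub Sg (vecSubst v) (pat Sg c) ≡ app c v
  sub-pat-vecSubst c v = cong (app c) (instArgs-vecSubst v)

  instΠ-cong : ∀ σ τ {n} → (∀ (i : Fin n) → σ (toℕ i) ≡ τ (toℕ i)) →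
               ∀ Π → instΠ Sg σ Π ≡ instΠ Sg τ Π
  instΠ-cong _ _ σ≗τ = map-cong σ≗τ

  instE-cong : ∀ σ τ {n} → (∀ (i : Fin n) → σ (toℕ i) ≡ τ (toℕ i)) →
               ∀ E → instE Sg σ E ≡ instE Sg τ E
  instE-cong _ _ σ≗τ nothing  = refl
  instE-cong _ _ σ≗τ (just q) = cong just (σ≗τ q)

  InL-connective : ∀ {L c args} → InL Sg L (app c args) → L c
  InL-connective (appL c∈L _) = c∈L

  atoms-InL : ∀ {L σ} c → InL Sg L (sub Sg σ (pat Sg c)) → ∀ i → InL Sg L (σ (toℕ i))
  atoms-InL {σ = σ} c (appL _ args∈L) i =
    subst (InL Sg _) (lookup-instArgs σ i) (VAllP.lookup⁺ args∈L i)

  instΠ-InL : ∀ {L} σ {n} → (∀ (i : Fin n) → InL Sg L (σ (toℕ i))) →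
              ∀ Π → All (InL Sg L) (instΠ Sg σ Π)
  instΠ-InL _ σ∈L Π = AllP.map⁺ (All.universal σ∈L Π)

  instE-InL : ∀ {L} σ {n} → (∀ (i : Fin n) → InL Sg L (σ (toℕ i))) →
              ∀ (E : Maybe (Fin n)) {φ} → instE Sg σ E ≡ just φ → InL Sg L φ
  instE-InL _ σ∈L (just q) refl = σ∈L q

++-⊆ : ∀ {A : Set} {xs ys zs : List A} → xs ⊆ zs → ys ⊆ zs → xs ++ ys ⊆ zs
++-⊆ {xs = xs} xs⊆zs ys⊆zs x∈ with ∈-++⁻ xs x∈
... | inj₁ x∈xs = xs⊆zs x∈xs
... | inj₂ x∈ys = ys⊆zs x∈ys

module _ {Sg : Signature} {L : Language Sg} {G : System Sg} {S : Sequent Sg → Set} where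
  open Signature Sg

  private
    D : List (Formula Sg) → Maybe (Formula Sg) → Set
    D Γ E = Der Sg L G S (Γ ⇒ E)

  Der⇒SeqIn : ∀ {s} → Der Sg L G S s → SeqIn Sg L s
  Der⇒SeqIn (hyp _ s∈L)               = s∈L
  Der⇒SeqIn (ax φ∈L)                  = φ∈L ∷ [] , λ { refl → φ∈L }
  Der⇒SeqIn (weak _ _ s∈L)            = s∈L
  Der⇒SeqIn (weakR _ s∈L)             = s∈L
  Der⇒SeqIn (cut _ _ s∈L)             = s∈L
  Der⇒SeqIn (rightI _ _ _ _ _ _ s∈L)  = s∈L
  Der⇒SeqIn (leftI _ _ _ _ _ _ _ s∈L) = s∈L

  weaken : ∀ {Γ Γ′ E} → Γ ⊆ Γ′ → All (InL Sg L) Γ′ → D Γ E → D Γ′ E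
  weaken Γ⊆Γ′ Γ′∈L d = weak Γ⊆Γ′ d (Γ′∈L , proj₂ (Der⇒SeqIn d))

  weakenʳ : ∀ {Γ E} → (∀ {φ} → E ≡ just φ → InL Sg L φ) → D Γ nothing → D Γ E
  weakenʳ {E = nothing} _   d = d
  weakenʳ {E = just _}  E∈L d = weakR d (proj₁ (Der⇒SeqIn d) , E∈L)

  cut′ : ∀ {Γ Δ φ E} → D Γ (just φ) → D (φ ∷ Δ) E → D (Γ ++ Δ) E
  cut′ d₁ d₂ with Der⇒SeqIn d₁ | Der⇒SeqIn d₂
  ... | Γ∈L , _ | _ ∷ Δ∈L , E∈L = cut d₁ d₂ (AllP.++⁺ Γ∈L Δ∈L , E∈L)

  -- σ need not be an L-substitution: it is replaced by one that agrees with
  -- it on the atoms of the rule.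
  rightI-restrict : ∀ {Γ c r σ} → Right G c r → All (InL Sg L) Γ → InL Sg L (sub Sg σ (pat Sg c)) →
                    All (λ cl → D (Γ ++ instΠ Sg σ (prem cl)) (instE Sg σ (concl cl))) r →
                    D Γ (just (sub Sg σ (pat Sg c)))
  rightI-restrict {Γ} {c} {r} {σ} rule Γ∈L φ∈L@(appL _ args∈L) premises =
    subst (λ φ → D Γ (just φ)) restricted-pat
      (rightI c r σ′ rule (vecSubst-InL args∈L) (All.map (λ {cl} → restrict cl) premises)
              (Γ∈L , λ { refl → subst (InL Sg L) (sym restricted-pat) φ∈L }))
    where
    σ′ = vecSubst (instArgs σ (arity c))

    restricted-pat : sub Sg σ′ (pat Sg c) ≡ sub Sg σ (pat Sg c)
    restricted-pat = sub-pat-vecSubst c (instArgs σ (arity c))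

    agree : ∀ i → σ (toℕ i) ≡ σ′ (toℕ i)
    agree i = sym (trans (vecSubst-toℕ _ i) (lookup-instArgs σ i))

    restrict : ∀ cl → D (Γ ++ instΠ Sg σ (prem cl)) (instE Sg σ (concl cl)) →
               D (Γ ++ instΠ Sg σ′ (prem cl)) (instE Sg σ′ (concl cl))
    restrict (Π ⇒c E) = subst₂ D (cong (Γ ++_) (instΠ-cong σ σ′ agree Π)) (instE-cong σ σ′ agree E)

module _ {Sg : Signature} {L L′ : Language Sg} {G G′ : System Sg} {S : Sequent Sg → Set}
         (L⊆L′ : ∀ c → L c → L′ c)
         (right⊆ : ∀ c r → Right G c r → Right G′ c r)
         (left⊆ : ∀ c l → Left G c l → Left G′ c l) where

  mutual
    InL-mono : ∀ {φ} → InL Sg L φ → InL Sg L′ φ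
    InL-mono (atomL p)         = atomL p
    InL-mono (appL c∈L args∈L) = appL (L⊆L′ _ c∈L) (InLᵛ-mono args∈L)

    InLᵛ-mono : ∀ {n} {v : Vec (Formula Sg) n} → VAll.All (InL Sg L) v → VAll.All (InL Sg L′) v
    InLᵛ-mono []             = []
    InLᵛ-mono (φ∈L ∷ v∈L) = InL-mono φ∈L ∷ InLᵛ-mono v∈L

  SeqIn-mono : ∀ {s} → SeqIn Sg L s → SeqIn Sg L′ s
  SeqIn-mono (Γ∈L , E∈L) = All.map InL-mono Γ∈L , InL-mono ∘ E∈L

  mutual
    Der-mono : ∀ {s} → Der Sg L G S s → Der Sg L′ G′ S s
    Der-mono (hyp s∈S s∈L)     = hyp s∈S (SeqIn-mono s∈L)
    Der-mono (ax φ∈L)          = ax (InL-mono φ∈L)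
    Der-mono (weak Γ⊆Γ′ d s∈L) = weak Γ⊆Γ′ (Der-mono d) (SeqIn-mono s∈L)
    Der-mono (weakR d s∈L)     = weakR (Der-mono d) (SeqIn-mono s∈L)
    Der-mono (cut d₁ d₂ s∈L)   = cut (Der-mono d₁) (Der-mono d₂) (SeqIn-mono s∈L)
    Der-mono (rightI c r σ rule σ∈L ds s∈L) =
      rightI c r σ (right⊆ c r rule) (InL-mono ∘ σ∈L) (Der-monoᴬ ds) (SeqIn-mono s∈L)
    Der-mono (leftI c l σ rule σ∈L ds es s∈L) =
      leftI c l σ (left⊆ c l rule) (InL-mono ∘ σ∈L) (Der-monoᴬ ds) (Der-monoᴬ es) (SeqIn-mono s∈L)

    Der-monoᴬ : ∀ {A : Set} {seq : A → Sequent Sg} {xs} →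
                All (λ x → Der Sg L G S (seq x)) xs → All (λ x → Der Sg L′ G′ S (seq x)) xs
    Der-monoᴬ []       = []
    Der-monoᴬ (d ∷ ds) = Der-mono d ∷ Der-monoᴬ ds

-- The orthogonality model

module Conservativity {Sg : Signature} {L₁ : Language Sg} {G₁ G₂ : System Sg}
  (coherent₂ : Coherent Sg G₂)
  (right₂ : ∀ c r → Right G₂ c r → Right G₁ c r ⊎ ¬ L₁ c)
  (left₂ : ∀ c l → Left G₂ c l → Left G₁ c l ⊎ ¬ L₁ c)
  (S : Sequent Sg → Set) (S⊆L₁ : ∀ s → S s → SeqIn Sg L₁ s) where

  open Signature Sg

  private
    F : Set
    F = Formula Sg

    InL₁ : F → Set
    InL₁ = InL Sg L₁

    Seq₁ : List F → Maybe F → Set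
    Seq₁ Δ E = SeqIn Sg L₁ (Δ ⇒ E)

    D : List F → Maybe F → Set
    D Δ E = Der Sg L₁ G₁ S (Δ ⇒ E)

  right₂⇒₁ : ∀ {c r} → L₁ c → Right G₂ c r → Right G₁ c r
  right₂⇒₁ c∈L rule = [ id , contradiction c∈L ]′ (right₂ _ _ rule)

  left₂⇒₁ : ∀ {c l} → L₁ c → Left G₂ c l → Left G₁ c l
  left₂⇒₁ c∈L rule = [ id , contradiction c∈L ]′ (left₂ _ _ rule)

  Test : Set₁
  Test = List F → Maybe F → Set

  Passes : Test → List F → Set
  Passes T X = ∀ {Δ E} → Seq₁ Δ E → T Δ E → D (X ++ Δ) E

  module _ {n : ℕ} (τ : Fin n → Test) where

    Target : Maybe (Fin n) → List F → Set
    Target (just q) Y = Passes (τ q) Y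
    Target nothing  Y = D Y nothing

    Premise : List F → List (Fin n) → (List F → Set) → Set
    Premise Θ Π T = ∀ {Y} → All InL₁ Y → Θ ⊆ Y → All (λ i → Passes (τ i) Y) Π → T Y

  LeftRuleTest : (c : Con) → (Fin (arity c) → Test) → Test
  LeftRuleTest c τ Δ E = ∃ λ (l : LeftRule Sg (arity c)) → Left G₂ c l ×
    All (λ cl → Premise τ Δ (prem cl) (Target τ (concl cl))) (proj₁ l) ×
    All (λ Σj → Premise τ Δ Σj (λ Y → D Y E)) (proj₂ l)

  -- The counters of the arguments are collected by recursion on the vector,
  -- since Counter (lookup args i) is not structurally recursive.
  mutual
    Counter : F → Test
    Counter (atom p)     Δ E = D (atom p ∷ Δ) E
    Counter (app c args) Δ E = D (app c args ∷ Δ) E ⊎ LeftRuleTest c (counters args) Δ E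

    counters : ∀ {n} → Vec F n → Fin n → Test
    counters (φ ∷ _)  zero    = Counter φ
    counters (_ ∷ φs) (suc i) = counters φs i

  Forces : F → List F → Set
  Forces φ = Passes (Counter φ)

  Holds : Maybe F → List F → Set
  Holds (just ψ) X = Forces ψ X
  Holds nothing  X = D X nothing

  Valid : List F → Maybe F → Set
  Valid Γ E = ∀ {X} → All InL₁ X → All (λ φ → Forces φ X) Γ → Holds E X

  counters-lookup : ∀ {n} (v : Vec F n) i → counters v i ≡ Counter (lookup v i)
  counters-lookup (_ ∷ _)  zero    = refl
  counters-lookup (_ ∷ φs) (suc i) = counters-lookup φs i

  counters-instArgs : ∀ σ {n} (i : Fin n) → counters (instArgs σ n) i ≡ Counter (σ (toℕ i))
  counters-instArgs σ {n} i =
    trans (counters-lookup (instArgs σ n) i) (cong Counter (lookup-instArgs σ i))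

  passes-mono : ∀ {T X Y} → Passes T X → X ⊆ Y → All InL₁ Y → Passes T Y
  passes-mono pass X⊆Y Y∈L {Δ} Δ∈L t =
    weaken (++⁺ˡ Δ X⊆Y) (AllP.++⁺ Y∈L (proj₁ Δ∈L)) (pass Δ∈L t)

  all-forces-mono : ∀ {Γ X Y} → All (λ φ → Forces φ X) Γ → X ⊆ Y → All InL₁ Y →
                    All (λ φ → Forces φ Y) Γ
  all-forces-mono []                  _   _   = []
  all-forces-mono (forces ∷ Γ-forced) X⊆Y Y∈L =
    passes-mono forces X⊆Y Y∈L ∷ all-forces-mono Γ-forced X⊆Y Y∈L

  counter-intro : ∀ {φ Δ E} → D (φ ∷ Δ) E → Counter φ Δ E
  counter-intro {atom _}  d = d
  counter-intro {app _ _} d = inj₁ d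

  mutual
    counter-elim : ∀ {φ Δ E} → InL₁ φ → Seq₁ Δ E → Counter φ Δ E → D (φ ∷ Δ) E
    counter-elim (atomL _)  _ d        = d
    counter-elim (appL _ _) _ (inj₁ d) = d
    counter-elim {app c args} {Δ} {E} φ∈L@(appL c∈L args∈L) (Δ∈L , E∈L)
                 (inj₂ (l , rule , lefts , sides)) =
      subst (λ φ → D (φ ∷ Δ) E) (sub-pat-vecSubst c args)
        (leftI c l σ (left₂⇒₁ c∈L rule) σ∈L
               (All.map (λ {cl} → left-premise cl) lefts) (All.map (λ {Σj} → side-premise Σj) sides)
               (subst InL₁ (sym (sub-pat-vecSubst c args)) φ∈L ∷ Δ∈L , E∈L))
      where
      σ = vecSubst args
      σ∈L = vecSubst-InL args∈L

      context∈L : ∀ Π → All InL₁ (Δ ++ instΠ Sg σ Π)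
      context∈L Π = AllP.++⁺ Δ∈L (instΠ-InL σ (σ∈L ∘ toℕ) Π)

      self : ∀ Π → All (λ i → Passes (counters args i) (Δ ++ instΠ Sg σ Π)) Π
      self Π = All.tabulate λ {i} i∈Π →
        passes-mono (forces-selfᵛ args∈L i)
          (∈-∷⁺ʳ (∈-++⁺ʳ Δ (subst (_∈ instΠ Sg σ Π) (vecSubst-toℕ args i) (∈-map⁺ _ i∈Π))) (λ ()))
          (context∈L Π)

      left-premise : ∀ cl → Premise (counters args) Δ (prem cl) (Target (counters args) (concl cl)) →
                     D (Δ ++ instΠ Sg σ (prem cl)) (instE Sg σ (concl cl))
      left-premise (Π ⇒c nothing) premise = premise (context∈L Π) (xs⊆xs++ys Δ _) (self Π)
      left-premise (Π ⇒c just q)  premise =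
        subst (λ ψ → D _ (just ψ)) (sym (vecSubst-toℕ args q))
          (forces⇒der (VAllP.lookup⁺ args∈L q)
            (subst (λ T → Passes T _) (counters-lookup args q)
              (premise (context∈L Π) (xs⊆xs++ys Δ _) (self Π))))

      side-premise : ∀ Σj → Premise (counters args) Δ Σj (λ Y → D Y E) → D (Δ ++ instΠ Sg σ Σj) E
      side-premise Σj premise = premise (context∈L Σj) (xs⊆xs++ys Δ _) (self Σj)

    forces-self : ∀ {φ} → InL₁ φ → Forces φ (φ ∷ [])
    forces-self φ∈L = counter-elim φ∈L

    forces-selfᵛ : ∀ {n} {v : Vec F n} → VAll.All InL₁ v →
                   ∀ i → Passes (counters v i) (lookup v i ∷ [])
    forces-selfᵛ (φ∈L ∷ _)   zero    = forces-self φ∈L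
    forces-selfᵛ (_   ∷ v∈L) (suc i) = forces-selfᵛ v∈L i

    forces⇒der : ∀ {ψ X} → InL₁ ψ → Forces ψ X → D X (just ψ)
    forces⇒der {ψ} {X} ψ∈L forces =
      subst (λ Y → D Y (just ψ)) (++-identityʳ X)
        (forces ([] , λ { refl → ψ∈L }) (counter-intro (ax ψ∈L)))

  der⇒forces : ∀ {ψ X} → InL₁ ψ → D X (just ψ) → Forces ψ X
  der⇒forces ψ∈L d Δ∈L t = cut′ d (counter-elim ψ∈L Δ∈L t)

  forces-members : ∀ {Ψ X} → All InL₁ Ψ → Ψ ⊆ X → All InL₁ X → All (λ φ → Forces φ X) Ψ
  forces-members Ψ∈L Ψ⊆X X∈L = All.tabulate λ φ∈Ψ →
    passes-mono (forces-self (All.lookup Ψ∈L φ∈Ψ)) (∈-∷⁺ʳ (Ψ⊆X φ∈Ψ) (λ ())) X∈L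

  holds⇒der : ∀ {X E} → Seq₁ X E → Holds E X → D X E
  holds⇒der {E = just ψ}  (_ , E∈L) forces = forces⇒der (E∈L refl) forces
  holds⇒der {E = nothing} _         d      = d

  der⇒holds : ∀ {X E} → (∀ {ψ} → E ≡ just ψ → InL₁ ψ) → D X E → Holds E X
  der⇒holds {E = just ψ}  E∈L d = der⇒forces (E∈L refl) d
  der⇒holds {E = nothing} _   d = d

  -- Cut the formulas of Γ one by one: the derivation itself, with φ moved to
  -- the front, is a counter of φ.
  cut-forced : ∀ {Γ Δ X E} → All InL₁ Γ → Seq₁ Δ E → X ⊆ Δ →
               All (λ φ → Forces φ X) Γ → D (Γ ++ Δ) E → D Δ E
  cut-forced []          _            _   []                  d = d
  cut-forced {φ ∷ Γ} {Δ} (φ∈L ∷ Γ∈L) (Δ∈L , E∈L) X⊆Δ (forces ∷ Γ-forced) d =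
    weaken (++-⊆ X⊆Δ ⊆-refl) Δ∈L
      (forces (Δ∈L , E∈L) (counter-intro
        (cut-forced Γ∈L (φ∈L ∷ Δ∈L , E∈L) (⊆-trans X⊆Δ (xs⊆x∷xs Δ φ)) Γ-forced
          (weaken (⊆-reflexive-↭ (↭-sym (shift φ Γ Δ))) (AllP.++⁺ Γ∈L (φ∈L ∷ Δ∈L)) d))))

  der⇒valid : ∀ {Γ E} → Seq₁ Γ E → D Γ E → Valid Γ E
  der⇒valid {Γ} (Γ∈L , E∈L) d {X} X∈L Γ-forced =
    der⇒holds E∈L (cut-forced Γ∈L (X∈L , E∈L) ⊆-refl Γ-forced
      (weaken (xs⊆xs++ys Γ X) (AllP.++⁺ Γ∈L X∈L) d))

  valid⇒der : ∀ {Γ E} → Seq₁ Γ E → Valid Γ E → D Γ E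
  valid⇒der Γ⇒E∈L@(Γ∈L , _) valid = holds⇒der Γ⇒E∈L (valid Γ∈L (forces-members Γ∈L ⊆-refl Γ∈L))

  valid⇒der-extend : ∀ {Γ Ψ X E} → All InL₁ X → All (λ φ → Forces φ X) Γ → Seq₁ Ψ E →
                     Valid (Γ ++ Ψ) E → D (X ++ Ψ) E
  valid⇒der-extend {Ψ = Ψ} {X} X∈L Γ-forced (Ψ∈L , E∈L) valid =
    holds⇒der (XΨ∈L , E∈L)
      (valid XΨ∈L (AllP.++⁺ (all-forces-mono Γ-forced (xs⊆xs++ys X Ψ) XΨ∈L)
                            (forces-members Ψ∈L (xs⊆ys++xs Ψ X) XΨ∈L)))
    where
    XΨ∈L = AllP.++⁺ X∈L Ψ∈L

  passes⇒forces-instΠ : ∀ σ {n Y} {Π : List (Fin n)} →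
                        All (λ i → Passes (counters (instArgs σ n) i) Y) Π →
                        All (λ φ → Forces φ Y) (instΠ Sg σ Π)
  passes⇒forces-instΠ σ {Y = Y} passes =
    AllP.map⁺ (All.map (λ {i} → subst (λ T → Passes T Y) (counters-instArgs σ i)) passes)

  holds⇒target : ∀ σ {n Y} (E : Maybe (Fin n)) →
                 Holds (instE Sg σ E) Y → Target (counters (instArgs σ n)) E Y
  holds⇒target σ {Y = Y} (just q) = subst (λ T → Passes T Y) (sym (counters-instArgs σ q))
  holds⇒target σ         nothing  = id

  valid⇒premise : ∀ σ {n Γ X Θ E} {Π : List (Fin n)} → All (λ φ → Forces φ X) Γ → X ⊆ Θ →
                  Valid (Γ ++ instΠ Sg σ Π) E → Premise (counters (instArgs σ n)) Θ Π (Holds E)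
  valid⇒premise σ Γ-forced X⊆Θ valid Y∈L Θ⊆Y passes =
    valid Y∈L (AllP.++⁺ (all-forces-mono Γ-forced (⊆-trans X⊆Θ Θ⊆Y) Y∈L)
                        (passes⇒forces-instΠ σ passes))

  -- A counter that is a G₁-derivation puts the connective in L₁, so the right
  -- rule is a G₁ rule and we cut.  A counter from a G₂ left rule is refuted by
  -- coherence, reading the premises of both rules as Horn clauses over P.
  valid-right : ∀ {Γ c r σ} → Right G₂ c r →
                All (λ cl → Valid (Γ ++ instΠ Sg σ (prem cl)) (instE Sg σ (concl cl))) r →
                Valid Γ (just (sub Sg σ (pat Sg c)))
  valid-right {Γ} {c} {r} {σ} rule premises {X} X∈L Γ-forced _ (inj₁ d) =
    cut′ (rightI-restrict (right₂⇒₁ (InL-connective φ∈L) rule) X∈L φ∈L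
                          (All.map (λ {cl} → premise cl) premises)) d
    where
    φ∈L : InL₁ (sub Sg σ (pat Sg c))
    φ∈L = All.head (proj₁ (Der⇒SeqIn d))

    premise : ∀ cl → Valid (Γ ++ instΠ Sg σ (prem cl)) (instE Sg σ (concl cl)) →
              D (X ++ instΠ Sg σ (prem cl)) (instE Sg σ (concl cl))
    premise (Π ⇒c E′) = valid⇒der-extend X∈L Γ-forced
      (instΠ-InL σ (atoms-InL c φ∈L) Π , instE-InL σ (atoms-InL c φ∈L) E′)
  valid-right {Γ} {c} {r} {σ} rule premises {X} X∈L Γ-forced {Δ} {E} (Δ∈L , E∈L)
              (inj₂ (l , left , lefts , sides)) =
    unsat-closed⇒goal (clauses Sg l r) (coherent₂ c l r left rule)
      (AllP.++⁺ (All.map (λ {cl} → left-closed cl) lefts)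
        (AllP.++⁺ (AllP.map⁺ (All.map (λ {Σj} → side-closed Σj) sides))
                  (All.map (λ {cl} → right-closed cl) premises)))
    where
    τ = counters (instArgs σ (arity c))
    Y = X ++ Δ
    Y∈L = AllP.++⁺ X∈L Δ∈L

    P : Fin (arity c) → Set
    P i = Passes (τ i) Y

    conclude : ∀ E′ → Target τ E′ Y → Conclusion P (D Y E) E′
    conclude (just q) pass = pass
    conclude nothing  d    = weakenʳ E∈L d

    left-closed : ∀ cl → Premise τ Δ (prem cl) (Target τ (concl cl)) → Closed P (D Y E) cl
    left-closed (Π ⇒c E′) premise passes = conclude E′ (premise Y∈L (xs⊆ys++xs Δ X) passes)

    side-closed : ∀ Σj → Premise τ Δ Σj (λ Z → D Z E) → Closed {Sg = Sg} P (D Y E) (Σj ⇒c nothing)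
    side-closed Σj premise = premise Y∈L (xs⊆ys++xs Δ X)

    right-closed : ∀ cl → Valid (Γ ++ instΠ Sg σ (prem cl)) (instE Sg σ (concl cl)) →
                   Closed P (D Y E) cl
    right-closed (Π ⇒c E′) valid passes = conclude E′
      (holds⇒target σ E′ (valid⇒premise σ Γ-forced (xs⊆xs++ys X Δ) valid Y∈L ⊆-refl passes))

  -- The principal formula is tested against the left rule itself.
  valid-left : ∀ {Γ E c l σ} → Left G₂ c l →
               All (λ cl → Valid (Γ ++ instΠ Sg σ (prem cl)) (instE Sg σ (concl cl))) (proj₁ l) →
               All (λ Σj → Valid (Γ ++ instΠ Sg σ Σj) E) (proj₂ l) →
               Valid (sub Sg σ (pat Sg c) ∷ Γ) E
  valid-left {Γ} {E} {c} {l} {σ} rule lefts sides {X} X∈L (φ-forced ∷ Γ-forced) = conclude E sides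
    where
    τ = counters (instArgs σ (arity c))

    left-premise : ∀ {Θ} → X ⊆ Θ →
                   ∀ cl → Valid (Γ ++ instΠ Sg σ (prem cl)) (instE Sg σ (concl cl)) →
                   Premise τ Θ (prem cl) (Target τ (concl cl))
    left-premise X⊆Θ (Π ⇒c E′) valid Y∈L Θ⊆Y passes =
      holds⇒target σ E′ (valid⇒premise σ Γ-forced X⊆Θ valid Y∈L Θ⊆Y passes)

    test : ∀ {Θ E′} → Seq₁ Θ E′ → X ⊆ Θ →
           All (λ Σj → Premise τ Θ Σj (λ Y → D Y E′)) (proj₂ l) → D (X ++ Θ) E′
    test Θ∈L X⊆Θ side-premises =
      φ-forced Θ∈L (inj₂ (l , rule , All.map (λ {cl} → left-premise X⊆Θ cl) lefts , side-premises))

    conclude : ∀ E → All (λ Σj → Valid (Γ ++ instΠ Sg σ Σj) E) (proj₂ l) → Holds E X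
    conclude nothing  valid-sides =
      weaken (++-⊆ ⊆-refl ⊆-refl) X∈L
        (test (X∈L , λ ()) ⊆-refl (All.map (valid⇒premise σ Γ-forced ⊆-refl) valid-sides))
    conclude (just ψ) valid-sides {Δ} (Δ∈L , E′∈L) counter =
      weaken (++-⊆ (xs⊆xs++ys X Δ) ⊆-refl) XΔ∈L
        (test (XΔ∈L , E′∈L) (xs⊆xs++ys X Δ) (All.map side-premise valid-sides))
      where
      XΔ∈L = AllP.++⁺ X∈L Δ∈L

      side-premise : ∀ {Σj} → Valid (Γ ++ instΠ Sg σ Σj) (just ψ) →
                     Premise τ (X ++ Δ) Σj (λ Y → D Y _)
      side-premise valid Y∈L XΔ⊆Y passes =
        weaken (++-⊆ ⊆-refl (⊆-trans (xs⊆ys++xs Δ X) XΔ⊆Y)) Y∈L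
          (valid⇒premise σ Γ-forced (xs⊆xs++ys X Δ) valid Y∈L XΔ⊆Y passes (Δ∈L , E′∈L) counter)

  mutual
    sound : ∀ {L Γ E} → Der Sg L G₂ S (Γ ⇒ E) → Valid Γ E
    sound (hyp s∈S _) = der⇒valid (S⊆L₁ _ s∈S) (hyp s∈S (S⊆L₁ _ s∈S))
    sound (ax _) _ (forces ∷ []) = forces
    sound (weak Γ⊆Γ′ d _) X∈L Γ′-forced = sound d X∈L (AllP.anti-mono Γ⊆Γ′ Γ′-forced)
    sound (weakR d _) X∈L Γ-forced (Δ∈L , E∈L) _ =
      weakenʳ E∈L (weaken (xs⊆xs++ys _ _) (AllP.++⁺ X∈L Δ∈L) (sound d X∈L Γ-forced))
    sound (cut {Γ} d₁ d₂ _) X∈L ΓΔ-forced with AllP.++⁻ Γ ΓΔ-forced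
    ... | Γ-forced , Δ-forced = sound d₂ X∈L (sound d₁ X∈L Γ-forced ∷ Δ-forced)
    sound (rightI _ _ _ rule _ ds _)   = valid-right rule (soundᴬ ds)
    sound (leftI _ _ _ rule _ ds es _) = valid-left rule (soundᴬ ds) (soundᴬ es)

    soundᴬ : ∀ {L} {A : Set} {Γ : A → List F} {E : A → Maybe F} {xs} →
             All (λ x → Der Sg L G₂ S (Γ x ⇒ E x)) xs → All (λ x → Valid (Γ x) (E x)) xs
    soundᴬ []       = []
    soundᴬ (d ∷ ds) = sound d ∷ soundᴬ ds

  conservative : ∀ {L s} → SeqIn Sg L₁ s → Der Sg L G₂ S s → Der Sg L₁ G₁ S s
  conservative {s = Γ ⇒ E} s∈L d = valid⇒der s∈L (sound d)

theorem7p3 : (Sg : Signature) (L₁ L₂ : Language Sg) (G₁ G₂ : System Sg) →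
    (∀ c → L₁ c → L₂ c) →
    RulesIn Sg L₁ G₁ → Coherent Sg G₁ →
    RulesIn Sg L₂ G₂ → Coherent Sg G₂ →
    AddsRulesOutside Sg L₁ G₁ G₂ →
    (S : Sequent Sg → Set) (s : Sequent Sg) →
    (∀ s′ → S s′ → SeqIn Sg L₁ s′) → SeqIn Sg L₁ s →
    (Der Sg L₁ G₁ S s → Der Sg L₂ G₂ S s) × (Der Sg L₂ G₂ S s → Der Sg L₁ G₁ S s)
theorem7p3 Sg L₁ L₂ G₁ G₂ L₁⊆L₂ _ _ _ coherent₂ (right₁⊆₂ , left₁⊆₂ , right₂ , left₂)
           S s S⊆L₁ s∈L₁ =
  Der-mono L₁⊆L₂ right₁⊆₂ left₁⊆₂ ,
  Conservativity.conservative coherent₂ right₂ left₂ S S⊆L₁ s∈L₁
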